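{- For any partition $\lambda$ of $n$, there are at most $n$ distinct partitions reachable from $\lambda$ in LCTR by a sequence of one or more moves.
   Context: A partition of $n$ is a finite weakly decreasing sequence of positive integers summing to $n$. LCTR moves: from nonempty $\lambda=(\lambda_1,\dots,\lambda_k)$ one may move to $T(\lambda)=(\lambda_2,\dots,\lambda_k)$ or $L(\lambda)=(\lambda_1-1,\dots,\lambda_k-1)$ (nonpositive entries omitted); the empty partition has no moves. -}

module Defs where

open import Data.Nat using (ℕ; zero; suc; _≤_; _≥_; _∸_)
open import Data.List using (List; []; _∷_)
open import Data.Nat.ListAction using (sum)
open import Data.Product using (_×_)
open import Relation.Binary.PropositionalEquality using (_≡_)
open import Data.List.Relation.Unary.All using (All)
open import Data.List.Relation.Unary.Linked using (Linked)

IsPartition : List ℕ → Set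
IsPartition λs = Linked _≥_ λs × All (λ x → 1 ≤ x) λs

IsPartitionOf : ℕ → List ℕ → Set
IsPartitionOf n λs = IsPartition λs × sum λs ≡ n

decAll : List ℕ → List ℕ
decAll [] = []
decAll (zero ∷ xs) = decAll xs
decAll (suc zero ∷ xs) = decAll xs
decAll (suc (suc k) ∷ xs) = suc k ∷ decAll xs

data Move : List ℕ → List ℕ → Set where
  T-move : ∀ x xs → Move (x ∷ xs) xs
  L-move : ∀ x xs → Move (x ∷ xs) (decAll (x ∷ xs))

data Reach : List ℕ → List ℕ → Set where
  step : ∀ {a b} → Move a b → Reach a b
  _then_ : ∀ {a b c} → Move a b → Reach b c → Reach a c

-- Every partition reachable in one or more moves from λ = (λ₁, …, λₖ) is of the
-- form Lʲ(λᵢ, …, λₖ) with 1 ≤ j < λᵢ, or is a proper suffix (λᵢ₊₁, …, λₖ):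
-- iterating L on a suffix starting with λᵢ empties it after λᵢ steps, and after
-- removing its first row by T it is again an L-iterate of the next suffix. These
-- candidates number Σᵢ ((λᵢ − 1) + 1) = n, and they are closed under both moves.
module Submission where

open import Defs
open import Data.Nat using (ℕ; _≤_)
open import Data.List using (List; length)
open import Data.List.Relation.Unary.All using (All)
open import Data.List.Relation.Unary.Unique.Propositional using (Unique)

open import Data.Nat using (zero; suc; _+_; _∸_; _≥_; z≤n; s≤s)
open import Data.Nat.Properties using (≤-trans; +-comm; module ≤-Reasoning)
open import Data.Nat.ListAction using (sum)
open import Data.List using ([]; _∷_; _++_; iterate)
open import Data.List.Properties using (length-++; length-iterate; length-removeAt′)
open import Data.List.Relation.Unary.All as All using ([]; _∷_)
open import Data.List.Relation.Unary.AllPairs using (AllPairs; []; _∷_)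
open import Data.List.Relation.Unary.Any using (here; there; index; _─_)
open import Data.List.Relation.Unary.Linked.Properties using (Linked⇒AllPairs)
open import Data.List.Membership.Propositional using (_∈_)
open import Data.List.Relation.Binary.Subset.Propositional using (_⊆_)
open import Data.List.Relation.Binary.Subset.Propositional.Properties using (xs⊆ys++xs; ++⁺ʳ)
open import Data.Empty using (⊥-elim)
open import Data.Product using (_,_)
open import Function using (id; flip; _∘_)
open import Relation.Binary.PropositionalEquality using (_≡_; _≢_; refl; sym; cong; cong₂; ≢-sym; module ≡-Reasoning)

∈-remove : ∀ {a} {A : Set a} {x y : A} {ys : List A} (x∈ys : x ∈ ys) →
           y ∈ ys → y ≢ x → y ∈ (ys ─ x∈ys)
∈-remove (here refl)  (here refl)  y≢x = ⊥-elim (y≢x refl)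
∈-remove (here refl)  (there y∈ys) _   = y∈ys
∈-remove (there _)    (here refl)  _   = here refl
∈-remove (there x∈ys) (there y∈ys) y≢x = there (∈-remove x∈ys y∈ys y≢x)

Unique∧⊆⇒length≤ : ∀ {a} {A : Set a} {xs ys : List A} →
                    Unique xs → xs ⊆ ys → length xs ≤ length ys
Unique∧⊆⇒length≤ [] _ = z≤n
Unique∧⊆⇒length≤ {xs = x ∷ xs} {ys} (x∉xs ∷ unique) xs⊆ys = begin
  suc (length xs)          ≤⟨ s≤s (Unique∧⊆⇒length≤ unique xs⊆ys─x) ⟩
  suc (length (ys ─ x∈ys)) ≡⟨ sym (length-removeAt′ ys (index x∈ys)) ⟩
  length ys                ∎
  where
  open ≤-Reasoning
  x∈ys : x ∈ ys
  x∈ys = xs⊆ys (here refl)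
  xs⊆ys─x : xs ⊆ (ys ─ x∈ys)
  xs⊆ys─x y∈xs = ∈-remove x∈ys (xs⊆ys (there y∈xs)) (≢-sym (All.lookup x∉xs y∈xs))

Descending : List ℕ → Set
Descending = AllPairs _≥_

decAll-≤ : ∀ {m xs} → All (_≤ suc m) xs → All (_≤ m) (decAll xs)
decAll-≤ {xs = []}              []              = []
decAll-≤ {xs = zero ∷ _}        (_ ∷ xs≤)       = decAll-≤ xs≤
decAll-≤ {xs = suc zero ∷ _}    (_ ∷ xs≤)       = decAll-≤ xs≤
decAll-≤ {xs = suc (suc _) ∷ _} (s≤s x≤ ∷ xs≤) = x≤ ∷ decAll-≤ xs≤

decAll-≡[] : ∀ {xs} → All (_≤ 1) xs → decAll xs ≡ []
decAll-≡[] {[]}              []             = refl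
decAll-≡[] {zero ∷ _}        (_ ∷ xs≤1)     = decAll-≡[] xs≤1
decAll-≡[] {suc zero ∷ _}    (_ ∷ xs≤1)     = decAll-≡[] xs≤1
decAll-≡[] {suc (suc _) ∷ _} (s≤s () ∷ _)

decAll-descending : ∀ {xs} → Descending xs → Descending (decAll xs)
decAll-descending {[]}              []            = []
decAll-descending {zero ∷ _}        (_ ∷ desc)    = decAll-descending desc
decAll-descending {suc zero ∷ _}    (_ ∷ desc)    = decAll-descending desc
decAll-descending {suc (suc _) ∷ _} (x≥xs ∷ desc) = decAll-≤ x≥xs ∷ decAll-descending desc

Move-descending : ∀ {a b} → Move a b → Descending a → Descending b
Move-descending (T-move _ _) (_ ∷ desc) = desc
Move-descending (L-move _ _) desc       = decAll-descending desc

candidates : List ℕ → List (List ℕ)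
candidates []       = []
candidates (x ∷ xs) = iterate decAll (decAll (x ∷ xs)) (x ∸ 1) ++ xs ∷ candidates xs

length-candidates : ∀ {xs} → All (1 ≤_) xs → length (candidates xs) ≡ sum xs
length-candidates {[]}        []        = refl
length-candidates {suc x ∷ xs} (_ ∷ pos) = begin
  length (iterate decAll (decAll (suc x ∷ xs)) x ++ xs ∷ candidates xs)
    ≡⟨ length-++ (iterate decAll _ x) ⟩
  length (iterate decAll _ x) + suc (length (candidates xs))
    ≡⟨ cong₂ (λ i c → i + suc c) (length-iterate decAll _ x) (length-candidates pos) ⟩
  x + suc (sum xs)
    ≡⟨ +-comm x (suc (sum xs)) ⟩
  suc (sum xs + x)
    ≡⟨ cong suc (+-comm (sum xs) x) ⟩
  suc x + sum xs ∎
  where open ≡-Reasoning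

[]∈candidates : ∀ x xs → [] ∈ candidates (x ∷ xs)
[]∈candidates x []       = xs⊆ys++xs _ _ (here refl)
[]∈candidates x (y ∷ ys) = xs⊆ys++xs _ _ (there ([]∈candidates y ys))

-- For x ≥ 2, L(x ∷ xs) = (x − 1) ∷ L xs has the same L-iterates as x ∷ xs, and its
-- remaining candidates come from the L-move on xs.
L-candidates : ∀ x xs → Descending (x ∷ xs) →
               decAll (x ∷ xs) ∷ candidates (decAll (x ∷ xs)) ⊆ candidates (x ∷ xs)
L-candidates zero xs (0≥xs ∷ _)
  rewrite decAll-≡[] (All.map (flip ≤-trans z≤n) 0≥xs) = λ { (here refl) → []∈candidates 0 xs }
L-candidates (suc zero) xs (1≥xs ∷ _)
  rewrite decAll-≡[] 1≥xs = λ { (here refl) → []∈candidates 1 xs }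
L-candidates (suc (suc _)) []       _          = id
L-candidates (suc (suc k)) (y ∷ ys) (_ ∷ desc) =
  ++⁺ʳ (iterate decAll (decAll (suc (suc k) ∷ y ∷ ys)) (suc k)) (there ∘ L-candidates y ys desc)

Move-candidates : ∀ {a b} → Move a b → Descending a → b ∷ candidates b ⊆ candidates a
Move-candidates (T-move _ _)  _    = xs⊆ys++xs _ _
Move-candidates (L-move x xs) desc = L-candidates x xs desc

Reach-candidates : ∀ {a c} → Reach a c → Descending a → c ∈ candidates a
Reach-candidates (step m)       desc = Move-candidates m desc (here refl)
Reach-candidates (m then reach) desc =
  Move-candidates m desc (there (Reach-candidates reach (Move-descending m desc)))

corollary3p17 : (n : ℕ) (lam : List ℕ) → IsPartitionOf n lam →
    (rs : List (List ℕ)) → Unique rs → All (Reach lam) rs →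
    length rs ≤ n
corollary3p17 n lam ((linked , positive) , sum≡n) rs unique reachable = begin
  length rs               ≤⟨ Unique∧⊆⇒length≤ unique rs⊆candidates ⟩
  length (candidates lam) ≡⟨ length-candidates positive ⟩
  sum lam                 ≡⟨ sum≡n ⟩
  n                       ∎
  where
  open ≤-Reasoning
  rs⊆candidates : rs ⊆ candidates lam
  rs⊆candidates r∈rs =
    Reach-candidates (All.lookup reachable r∈rs) (Linked⇒AllPairs (flip ≤-trans) linked)
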